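{- Let $N$ be a positive integer and $k\ge2$ an integer. Let $\mathcal C(N,k)$ be the set of weak compositions $\mathbf d=(d_0,\ldots,d_{k-1})$ of $N$ into $k$ parts. Fix $\mathbf c=(c_0,\ldots,c_{k-1})\in\mathcal C(N,k)$ and let $\mathbf e_0,\ldots,\mathbf e_{k-1}$ be the standard basis vectors of $\mathbb Z^k$ (indexed from $0$). Define $\mathbf c_0=\mathbf c$ and $\mathbf c_j=(c_{j,0},\ldots,c_{j,k-1})=\mathbf c+\mathbf e_{k-1}-\mathbf e_{j-1}$ for $j=1,\ldots,k-1$; writing also $\mathbf c_0=(c_{0,0},\ldots,c_{0,k-1})$. For $0\le j\le k-1$ let $$\mathcal C(\mathbf c_j)=\{\mathbf d\in\mathcal C(N,k):\ d_j+d_{j+1}+\cdots+d_{j+i}\ge c_{j,j}+c_{j,j+1}+\cdots+c_{j,j+i}\text{ for } i=0,\ldots,k-2\},$$ where all indices are read modulo $k$, and where $\mathcal C(\mathbf c_j)$ is taken to be empty if $\mathbf c_j$ has a negative entry. Then $\mathcal C(N,k)$ is the disjoint union $\coprod_{0\le j\le k-1}\mathcal C(\mathbf c_j)$. -}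

module Defs where

open import Data.Nat using (ℕ; zero; suc; _+_; _∸_; _<_; NonZero; _≡ᵇ_)
open import Data.Nat.DivMod using (_%_; m%n<n)
open import Data.Fin using (Fin; zero; suc; toℕ; fromℕ<)
open import Data.Integer as ℤ using (ℤ; +_; _-_; _≤_)
open import Data.Bool using (if_then_else_)
open import Data.Product using (_×_)
open import Relation.Binary.PropositionalEquality using (_≡_)

∑ : ∀ {k} → (Fin k → ℕ) → ℕ
∑ {zero}  f = 0
∑ {suc k} f = f zero + ∑ (λ t → f (suc t))

WeakComp : (N k : ℕ) → (Fin k → ℕ) → Set
WeakComp N k d = ∑ d ≡ N

idx : (k : ℕ) .{{_ : NonZero k}} → ℕ → Fin k
idx k n = fromℕ< (m%n<n n k)

∑ℤ : (ℕ → ℤ) → ℕ → ℤ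
∑ℤ f zero    = + 0
∑ℤ f (suc n) = ∑ℤ f n ℤ.+ f n

ind : Data.Bool.Bool → ℤ
ind b = if b then + 1 else + 0

-- c_j as an integer vector:  c_0 = c,  c_j = c + e_{k-1} - e_{j-1}  (1 ≤ j ≤ k-1)
cvec : ∀ {k} → (Fin k → ℕ) → Fin k → Fin k → ℤ
cvec c zero t = + c t
cvec {suc k′} c (suc j) t =
  (+ c t ℤ.+ ind (toℕ t ≡ᵇ k′)) - ind (toℕ t ≡ᵇ toℕ j)

InC : (k : ℕ) .{{_ : NonZero k}} → (Fin k → ℕ) → Fin k → (Fin k → ℕ) → Set
InC k c j d =
  (∀ t → + 0 ≤ cvec c j t) ×
  (∀ i → i < k ∸ 1 →
     ∑ℤ (λ s → cvec c j (idx k (toℕ j + s))) (suc i)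
       ≤ ∑ℤ (λ s → + d (idx k (toℕ j + s))) (suc i))

-- Let X m = ∑_{s<m} (d_s − c_s), indices mod k; as ∑ c = ∑ d, X is k-periodic.
-- Replacing c by c_j changes these partial sums only by the number of visits to
-- positions j−1 and k−1, so the window inequalities defining 𝒞(c_j) say exactly
-- that X j < X m for m < j and X j ≤ X m for j < m < k: j is the first index at
-- which X attains its minimum over a period, and such an index exists and is unique.
-- Nonnegativity of c_j is then automatic, since c_{j−1} = 0 would give X j ≥ X (j−1).

module Submission where

open import Defs
open import Data.Nat using (ℕ; _≤_; NonZero)
open import Data.Fin using (Fin)
open import Data.Product using (∃!)
open import Relation.Binary.PropositionalEquality using (_≡_)

open import Data.Bool using (true; false)
open import Data.Empty using (⊥-elim)
open import Data.Fin as Fin using (zero; suc; toℕ; fromℕ<; inject₁)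
import Data.Fin.Properties as Fin
open import Data.Integer as ℤ using (ℤ; +_; -_; _-_)
import Data.Integer.Properties as ℤ
open import Data.Integer.Tactic.RingSolver using (solve-∀)
open import Data.Nat as ℕ using (zero; suc; _+_; _∸_; _<_; _≡ᵇ_; z≤n; s≤s; _≤?_)
import Data.Nat.Properties as ℕ
open import Data.Nat.DivMod using (_%_; m<n⇒m%n≡m; [m+n]%n≡m%n)
open import Data.Product using (_×_; _,_; proj₂; ∃-syntax)
open import Data.Sum using (_⊎_; inj₁; inj₂)
open import Function using (_∘_)
open import Function.Bundles using (_⇔_; mk⇔; Equivalence)
open import Relation.Binary.Definitions using (tri<; tri≈; tri>)
open import Relation.Binary.PropositionalEquality
  using (_≢_; refl; sym; trans; cong; cong₂; subst; subst₂; module ≡-Reasoning)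
open import Relation.Nullary using (yes; no)

open import Algebra.Properties.CommutativeSemigroup ℤ.+-commutativeSemigroup using (interchange)

∑ℤ-cong : ∀ {f g : ℕ → ℤ} → (∀ s → f s ≡ g s) → ∀ n → ∑ℤ f n ≡ ∑ℤ g n
∑ℤ-cong f≗g zero    = refl
∑ℤ-cong f≗g (suc n) = cong₂ ℤ._+_ (∑ℤ-cong f≗g n) (f≗g n)

∑ℤ-+ : ∀ (f g : ℕ → ℤ) n → ∑ℤ (λ s → f s ℤ.+ g s) n ≡ ∑ℤ f n ℤ.+ ∑ℤ g n
∑ℤ-+ f g zero    = refl
∑ℤ-+ f g (suc n) rewrite ∑ℤ-+ f g n = interchange (∑ℤ f n) (∑ℤ g n) (f n) (g n)

∑ℤ-neg : ∀ (f : ℕ → ℤ) n → ∑ℤ (λ s → - f s) n ≡ - ∑ℤ f n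
∑ℤ-neg f zero    = refl
∑ℤ-neg f (suc n) rewrite ∑ℤ-neg f n = sym (ℤ.neg-distrib-+ (∑ℤ f n) (f n))

∑ℤ-- : ∀ (f g : ℕ → ℤ) n → ∑ℤ (λ s → f s - g s) n ≡ ∑ℤ f n - ∑ℤ g n
∑ℤ-- f g n = trans (∑ℤ-+ f (λ s → - g s) n) (cong (λ x → ∑ℤ f n ℤ.+ x) (∑ℤ-neg g n))

∑ℤ-split : ∀ (f : ℕ → ℤ) m n → ∑ℤ f (m + n) ≡ ∑ℤ f m ℤ.+ ∑ℤ (λ s → f (m + s)) n
∑ℤ-split f m zero    rewrite ℕ.+-identityʳ m = sym (ℤ.+-identityʳ (∑ℤ f m))
∑ℤ-split f m (suc n) rewrite ℕ.+-suc m n | ∑ℤ-split f m n =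
  ℤ.+-assoc (∑ℤ f m) (∑ℤ (λ s → f (m + s)) n) (f (m + n))

∑ℤ-∑ : ∀ {n} (e : Fin n → ℕ) (f : ℕ → ℤ) → (∀ i → f (toℕ i) ≡ + e i) → ∑ℤ f n ≡ + ∑ e
∑ℤ-∑ {zero}  e f f≗e = refl
∑ℤ-∑ {suc n} e f f≗e = begin
  ∑ℤ f (1 + n)                         ≡⟨ ∑ℤ-split f 1 n ⟩
  (+ 0 ℤ.+ f 0) ℤ.+ ∑ℤ (f ∘ suc) n     ≡⟨ cong₂ ℤ._+_ (trans (ℤ.+-identityˡ (f 0)) (f≗e zero))
                                                      (∑ℤ-∑ (e ∘ suc) (f ∘ suc) (f≗e ∘ suc)) ⟩
  + e zero ℤ.+ + ∑ (e ∘ suc)           ≡⟨ ℤ.pos-+ (e zero) (∑ (e ∘ suc)) ⟨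
  + ∑ e                                ∎
  where open ≡-Reasoning

≤-window⇔ : ∀ (f g : ℕ → ℤ) m n →
            (∑ℤ (λ s → f (m + s)) n ℤ.≤ ∑ℤ (λ s → g (m + s)) n) ⇔
            (∑ℤ (λ s → g s - f s) m ℤ.≤ ∑ℤ (λ s → g s - f s) (m + n))
≤-window⇔ f g m n = mk⇔ to from
  where
  F G start : ℤ
  F = ∑ℤ (λ s → f (m + s)) n
  G = ∑ℤ (λ s → g (m + s)) n
  start = ∑ℤ (λ s → g s - f s) m

  end≡ : ∑ℤ (λ s → g s - f s) (m + n) ≡ start ℤ.+ (G - F)
  end≡ = trans (∑ℤ-split _ m n) (cong (λ x → start ℤ.+ x) (∑ℤ-- (λ s → g (m + s)) (λ s → f (m + s)) n))

  cancel : ∀ x y → (x ℤ.+ y) - x ≡ y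
  cancel = solve-∀

  to : F ℤ.≤ G → start ℤ.≤ ∑ℤ (λ s → g s - f s) (m + n)
  to F≤G = subst₂ ℤ._≤_ (ℤ.+-identityʳ start) (sym end≡) (ℤ.+-monoʳ-≤ start (ℤ.i≤j⇒0≤j-i F≤G))

  from : start ℤ.≤ ∑ℤ (λ s → g s - f s) (m + n) → F ℤ.≤ G
  from start≤end = ℤ.0≤i-j⇒j≤i (subst (ℤ.+ 0 ℤ.≤_) (trans (cong (_- start) end≡) (cancel start (G - F)))
                                                   (ℤ.i≤j⇒0≤j-i start≤end))

+-cancelˡ-≤ : ∀ i {x y} → i ℤ.+ x ℤ.≤ i ℤ.+ y → x ℤ.≤ y
+-cancelˡ-≤ i {x} {y} i+x≤i+y = subst₂ ℤ._≤_ (cancel i x) (cancel i y) (ℤ.+-monoʳ-≤ (- i) i+x≤i+y)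
  where
  cancel : ∀ a z → - a ℤ.+ (a ℤ.+ z) ≡ z
  cancel = solve-∀

record LeastArgMin (f : ℕ → ℤ) (n j : ℕ) : Set where
  field
    before : ∀ {m} → m < j → f j ℤ.< f m
    after  : ∀ {m} → j < m → m < n → f j ℤ.≤ f m

  minimal : ∀ {m} → m < n → f j ℤ.≤ f m
  minimal {m} m<n with ℕ.<-cmp m j
  ... | tri< m<j _ _ = ℤ.<⇒≤ (before m<j)
  ... | tri≈ _ refl _ = ℤ.≤-refl
  ... | tri> _ _ j<m = after j<m m<n

leastArgMin-unique : ∀ {f n i j} → i < n → j < n → LeastArgMin f n i → LeastArgMin f n j → i ≡ j
leastArgMin-unique {i = i} {j} i<n j<n min-i min-j with ℕ.<-cmp i j
... | tri< i<j _ _ = ⊥-elim (ℤ.<⇒≱ (LeastArgMin.before min-j i<j) (LeastArgMin.after min-i i<j j<n))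
... | tri≈ _ i≡j _ = i≡j
... | tri> _ _ j<i = ⊥-elim (ℤ.<⇒≱ (LeastArgMin.before min-i j<i) (LeastArgMin.after min-j j<i i<n))

leastArgMin-exists : ∀ f n → ∃[ j ] j < suc n × LeastArgMin f (suc n) j
leastArgMin-exists f zero = 0 , s≤s z≤n , record { before = λ () ; after = λ { {suc _} _ (s≤s ()) } }
leastArgMin-exists f (suc n) with leastArgMin-exists f n
... | j , j<1+n , min-j with f (suc n) ℤ.<? f j
...   | yes new<old = suc n , ℕ.n<1+n (suc n) , record
          { before = λ m<1+n → ℤ.<-≤-trans new<old (LeastArgMin.minimal min-j m<1+n)
          ; after  = λ 1+n<m m<2+n → ⊥-elim (ℕ.<-irrefl refl (ℕ.<-≤-trans 1+n<m (ℕ.s≤s⁻¹ m<2+n))) }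
...   | no new≮old = j , ℕ.m<n⇒m<1+n j<1+n , record { before = LeastArgMin.before min-j ; after = after }
  where
  after : ∀ {m} → j < m → m < suc (suc n) → f j ℤ.≤ f m
  after j<m m<2+n with ℕ.m≤n⇒m<n∨m≡n (ℕ.s≤s⁻¹ m<2+n)
  ... | inj₁ m<1+n = LeastArgMin.after min-j j<m m<1+n
  ... | inj₂ refl = ℤ.≮⇒≥ new≮old

window-end-inside : ∀ {k j m} → j < m → m ≤ k → ∃[ i ] i < k × j + suc i ≡ m
window-end-inside {k} {j} {m} j<m m≤k = i , ℕ.<-≤-trans i<m m≤k , end≡m
  where
  i : ℕ
  i = m ∸ suc j
  end≡m : j + suc i ≡ m
  end≡m = trans (ℕ.+-suc j i) (ℕ.m+[n∸m]≡n j<m)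
  i<m : i < m
  i<m = subst (i <_) end≡m (ℕ.<-≤-trans (ℕ.n<1+n i) (ℕ.m≤n+m (suc i) j))

window-end-wrapped : ∀ {k j r} → j ≤ k → r < j → ∃[ i ] i < k × j + suc i ≡ suc k + r
window-end-wrapped {k} {j} {r} j≤k r<j = i , i<k , trans (ℕ.+-suc j i) (cong suc end≡)
  where
  i : ℕ
  i = k ∸ j + r
  end≡ : j + i ≡ k + r
  end≡ = trans (sym (ℕ.+-assoc j (k ∸ j) r)) (cong (_+ r) (ℕ.m+[n∸m]≡n j≤k))
  i<k : i < k
  i<k = subst (i <_) (trans (ℕ.+-comm (k ∸ j) j) (ℕ.m+[n∸m]≡n j≤k)) (ℕ.+-monoʳ-< (k ∸ j) r<j)

window-end-cases : ∀ {k j i} → i < k → j + suc i ≤ k ⊎ ∃[ r ] r < j × j + suc i ≡ suc k + r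
window-end-cases {k} {j} {i} i<k with j + suc i ≤? k
... | yes end≤k = inj₁ end≤k
... | no end≰k = inj₂ (r , r<j , sym end≡)
  where
  r : ℕ
  r = j + suc i ∸ suc k
  end≡ : suc k + r ≡ j + suc i
  end≡ = ℕ.m+[n∸m]≡n (ℕ.≰⇒> end≰k)
  r<j : r < j
  r<j = ℕ.+-cancelˡ-< (suc k) r j
          (subst₂ _<_ (sym end≡) (ℕ.+-comm j (suc k)) (ℕ.+-monoʳ-< j (s≤s i<k)))

ind-≢ : ∀ {m n} → m ≢ n → ind (m ≡ᵇ n) ≡ + 0
ind-≢ {m} {n} m≢n with m ≡ᵇ n | ℕ.≡ᵇ⇒≡ m n
... | false | _      = refl
... | true  | m≡ᵇn⇒ = ⊥-elim (m≢n (m≡ᵇn⇒ _))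

ind-refl : ∀ n → ind (n ≡ᵇ n) ≡ + 1
ind-refl n with n ≡ᵇ n | ℕ.≡⇒≡ᵇ n n refl
... | true | _ = refl

≤-+-ind : ∀ x b → x ℤ.≤ x ℤ.+ ind b
≤-+-ind x true  = ℤ.i≤i+j x (+ 1)
≤-+-ind x false = ℤ.i≤i+j x (+ 0)

cvec-suc-nonneg : ∀ {k} (c : Fin (suc k) → ℕ) (j : Fin k) → c (inject₁ j) ≢ 0 →
                  ∀ t → + 0 ℤ.≤ cvec c (suc j) t
cvec-suc-nonneg {k} c j cⱼ≢0 t =
  ℤ.i≤j⇒0≤j-i (ℤ.≤-trans removed≤cₜ (≤-+-ind (+ c t) (toℕ t ≡ᵇ k)))
  where
  removed≤cₜ : ind (toℕ t ≡ᵇ toℕ j) ℤ.≤ + c t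
  removed≤cₜ with toℕ t ≡ᵇ toℕ j | ℕ.≡ᵇ⇒≡ (toℕ t) (toℕ j)
  ... | false | _ = ℤ.+≤+ z≤n
  ... | true  | t≡ᵇj⇒ = ℤ.+≤+ (subst (λ u → 0 < c u) (sym t≡j) (ℕ.n≢0⇒n>0 cⱼ≢0))
    where
    t≡j : t ≡ inject₁ j
    t≡j = Fin.toℕ-injective (trans (t≡ᵇj⇒ _) (sym (Fin.toℕ-inject₁ j)))

module _ {k : ℕ} (c d : Fin (suc k) → ℕ) where

  at : ℕ → Fin (suc k)
  at = idx (suc k)

  toℕ-at : ∀ {s} → s < suc k → toℕ (at s) ≡ s
  toℕ-at s<1+k = trans (Fin.toℕ-fromℕ< _) (m<n⇒m%n≡m s<1+k)

  at-toℕ : ∀ i → at (toℕ i) ≡ i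
  at-toℕ i = Fin.toℕ-injective (toℕ-at (Fin.toℕ<n i))

  at-periodic : ∀ s → at (suc k + s) ≡ at s
  at-periodic s = Fin.toℕ-injective (begin
    toℕ (at (suc k + s))  ≡⟨ Fin.toℕ-fromℕ< _ ⟩
    (suc k + s) % suc k   ≡⟨ cong (_% suc k) (ℕ.+-comm (suc k) s) ⟩
    (s + suc k) % suc k   ≡⟨ [m+n]%n≡m%n s (suc k) ⟩
    s % suc k             ≡⟨ Fin.toℕ-fromℕ< _ ⟨
    toℕ (at s)            ∎)
    where open ≡-Reasoning

  ∑ℤ-periodic : ∀ (g : Fin (suc k) → ℤ) r →
                ∑ℤ (g ∘ at) (suc k + r) ≡ ∑ℤ (g ∘ at) (suc k) ℤ.+ ∑ℤ (g ∘ at) r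
  ∑ℤ-periodic g r = trans (∑ℤ-split (g ∘ at) (suc k) r)
                          (cong (λ x → ∑ℤ (g ∘ at) (suc k) ℤ.+ x) (∑ℤ-cong (cong g ∘ at-periodic) r))

  excess : ℕ → ℤ
  excess = ∑ℤ (λ s → + d (at s) - + c (at s))

  excess-periodic : ∑ c ≡ ∑ d → ∀ r → excess (suc k + r) ≡ excess r
  excess-periodic ∑c≡∑d r = begin
    excess (suc k + r)                               ≡⟨ ∑ℤ-periodic (λ t → + d t - + c t) r ⟩
    excess (suc k) ℤ.+ excess r                      ≡⟨ cong (ℤ._+ excess r) full-period ⟩
    + 0 ℤ.+ excess r                                 ≡⟨ ℤ.+-identityˡ (excess r) ⟩
    excess r                                         ∎
    where
    open ≡-Reasoning
    full-period : excess (suc k) ≡ + 0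
    full-period = begin
      excess (suc k)                                 ≡⟨ ∑ℤ-- (λ s → + d (at s)) (λ s → + c (at s)) (suc k) ⟩
      ∑ℤ (λ s → + d (at s)) (suc k) - ∑ℤ (λ s → + c (at s)) (suc k)
        ≡⟨ cong₂ _-_ (∑ℤ-∑ d _ (cong (λ t → + d t) ∘ at-toℕ)) (∑ℤ-∑ c _ (cong (λ t → + c t) ∘ at-toℕ)) ⟩
      + ∑ d - + ∑ c                                  ≡⟨ cong (λ n → + ∑ d - + n) ∑c≡∑d ⟩
      + ∑ d - + ∑ d                                  ≡⟨ ℤ.+-inverseʳ (+ ∑ d) ⟩
      + 0                                            ∎

  visits : ℕ → ℕ → ℤ
  visits a = ∑ℤ (λ s → ind (toℕ (at s) ≡ᵇ a))

  visits-before : ∀ {a m} → m ≤ a → m ≤ suc k → visits a m ≡ + 0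
  visits-before {m = zero}  _   _    = refl
  visits-before {a} {suc m} m<a m<1+k =
    cong₂ ℤ._+_ (visits-before (ℕ.<⇒≤ m<a) (ℕ.<⇒≤ m<1+k))
                (trans (cong (λ u → ind (u ≡ᵇ a)) (toℕ-at m<1+k)) (ind-≢ (ℕ.<⇒≢ m<a)))

  visits-after : ∀ {a m} → a < m → m ≤ suc k → visits a m ≡ + 1
  visits-after {a} {suc m} a<1+m m<1+k with ℕ.m≤n⇒m<n∨m≡n (ℕ.s≤s⁻¹ a<1+m)
  ... | inj₁ a<m = cong₂ ℤ._+_ (visits-after a<m (ℕ.<⇒≤ m<1+k))
                               (trans (cong (λ u → ind (u ≡ᵇ a)) (toℕ-at m<1+k)) (ind-≢ (ℕ.>⇒≢ a<m)))
  ... | inj₂ refl = cong₂ ℤ._+_ (visits-before ℕ.≤-refl (ℕ.<⇒≤ m<1+k))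
                                (trans (cong (λ u → ind (u ≡ᵇ a)) (toℕ-at m<1+k)) (ind-refl a))

  visits-periodic : ∀ {a} → a < suc k → ∀ r → visits a (suc k + r) ≡ + 1 ℤ.+ visits a r
  visits-periodic {a} a<1+k r = trans (∑ℤ-periodic (λ t → ind (toℕ t ≡ᵇ a)) r)
                                      (cong (ℤ._+ visits a r) (visits-after a<1+k ℕ.≤-refl))

  excessOver : Fin (suc k) → ℕ → ℤ
  excessOver j = ∑ℤ (λ s → + d (at s) - cvec c j (at s))

  excessOver-suc : ∀ (j : Fin k) m →
                   excessOver (suc j) m ≡ excess m ℤ.+ (visits (toℕ j) m - visits k m)
  excessOver-suc j m = begin
    excessOver (suc j) m
      ≡⟨ ∑ℤ-cong (λ s → regroup (+ d (at s)) (+ c (at s)) (ind (toℕ (at s) ≡ᵇ k)) (ind (toℕ (at s) ≡ᵇ toℕ j))) m ⟩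
    ∑ℤ (λ s → (+ d (at s) - + c (at s)) ℤ.+ (ind (toℕ (at s) ≡ᵇ toℕ j) - ind (toℕ (at s) ≡ᵇ k))) m
      ≡⟨ ∑ℤ-+ _ _ m ⟩
    excess m ℤ.+ ∑ℤ (λ s → ind (toℕ (at s) ≡ᵇ toℕ j) - ind (toℕ (at s) ≡ᵇ k)) m
      ≡⟨ cong (λ x → excess m ℤ.+ x) (∑ℤ-- _ _ m) ⟩
    excess m ℤ.+ (visits (toℕ j) m - visits k m)
      ∎
    where
    open ≡-Reasoning
    regroup : ∀ x y u v → x - ((y ℤ.+ u) - v) ≡ (x - y) ℤ.+ (v - u)
    regroup = solve-∀

  offset : Fin (suc k) → ℤ
  offset zero    = + 0
  offset (suc _) = + 1

  offset-suc : ∀ {j m} → m < toℕ j → offset j ≡ + 1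
  offset-suc {suc _} _ = refl

  excessOver-unwrapped : ∀ j {m} → toℕ j ≤ m → m < suc k → excessOver j m ≡ offset j ℤ.+ excess m
  excessOver-unwrapped zero    {m} _   _     = sym (ℤ.+-identityˡ (excess m))
  excessOver-unwrapped (suc j) {m} j<m m<1+k = begin
    excessOver (suc j) m                         ≡⟨ excessOver-suc j m ⟩
    excess m ℤ.+ (visits (toℕ j) m - visits k m) ≡⟨ cong₂ (λ x y → excess m ℤ.+ (x - y))
                                                          (visits-after j<m (ℕ.<⇒≤ m<1+k))
                                                          (visits-before (ℕ.s≤s⁻¹ m<1+k) (ℕ.<⇒≤ m<1+k)) ⟩
    excess m ℤ.+ + 1                             ≡⟨ ℤ.+-comm (excess m) (+ 1) ⟩
    + 1 ℤ.+ excess m                             ∎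
    where open ≡-Reasoning

  excessOver-wrapped : ∑ c ≡ ∑ d → ∀ j {r} → r < toℕ j → excessOver j (suc k + r) ≡ excess r
  excessOver-wrapped ∑c≡∑d (suc j) {r} r<1+j = begin
    excessOver (suc j) (suc k + r)
      ≡⟨ excessOver-suc j (suc k + r) ⟩
    excess (suc k + r) ℤ.+ (visits (toℕ j) (suc k + r) - visits k (suc k + r))
      ≡⟨ cong₂ (λ x y → x ℤ.+ y) (excess-periodic ∑c≡∑d r)
               (cong₂ _-_ (visits-periodic j<1+k r) (visits-periodic ℕ.≤-refl r)) ⟩
    excess r ℤ.+ ((+ 1 ℤ.+ visits (toℕ j) r) - (+ 1 ℤ.+ visits k r))
      ≡⟨ cong₂ (λ x y → excess r ℤ.+ ((+ 1 ℤ.+ x) - (+ 1 ℤ.+ y)))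
               (visits-before r≤j (ℕ.<⇒≤ r<1+k)) (visits-before r≤k (ℕ.<⇒≤ r<1+k)) ⟩
    excess r ℤ.+ + 0
      ≡⟨ ℤ.+-identityʳ (excess r) ⟩
    excess r
      ∎
    where
    open ≡-Reasoning
    j<1+k : toℕ j < suc k
    j<1+k = ℕ.m<n⇒m<1+n (Fin.toℕ<n j)
    r≤j : r ≤ toℕ j
    r≤j = ℕ.s≤s⁻¹ r<1+j
    r≤k : r ≤ k
    r≤k = ℕ.<⇒≤ (ℕ.≤-<-trans r≤j (Fin.toℕ<n j))
    r<1+k : r < suc k
    r<1+k = s≤s r≤k

  excess-step-≥ : ∀ {m} → c (at m) ≡ 0 → excess m ℤ.≤ excess (suc m)
  excess-step-≥ {m} cₘ≡0 rewrite cₘ≡0 = ℤ.i≤i+j (excess m) (+ d (at m) - + 0)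

  leastArgMin⇒cvec-nonneg : ∀ j → LeastArgMin excess (suc k) (toℕ j) → ∀ t → + 0 ℤ.≤ cvec c j t
  leastArgMin⇒cvec-nonneg zero    _   t = ℤ.+≤+ z≤n
  leastArgMin⇒cvec-nonneg (suc j) min = cvec-suc-nonneg c j cⱼ≢0
    where
    at-j : at (toℕ j) ≡ inject₁ j
    at-j = trans (cong at (sym (Fin.toℕ-inject₁ j))) (at-toℕ (inject₁ j))
    cⱼ≢0 : c (inject₁ j) ≢ 0
    cⱼ≢0 cⱼ≡0 = ℤ.<⇒≱ (LeastArgMin.before min (ℕ.n<1+n (toℕ j)))
                      (excess-step-≥ {toℕ j} (trans (cong c at-j) cⱼ≡0))

  Rises : Fin (suc k) → ℕ → Set
  Rises j i = excessOver j (toℕ j) ℤ.≤ excessOver j (toℕ j + suc i)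

  InC⇔nonneg×rises : ∀ j → InC (suc k) c j d ⇔ ((∀ t → + 0 ℤ.≤ cvec c j t) × (∀ i → i < k → Rises j i))
  InC⇔nonneg×rises j = mk⇔ (λ (nonneg , windows) → nonneg , λ i i<k → Equivalence.to (window⇔ i) (windows i i<k))
                           (λ (nonneg , rises) → nonneg , λ i i<k → Equivalence.from (window⇔ i) (rises i i<k))
    where
    window⇔ : ∀ i → _ ⇔ Rises j i
    window⇔ i = ≤-window⇔ (cvec c j ∘ at) (λ s → + d (at s)) (toℕ j) (suc i)

  excessOver-start : ∀ j → excessOver j (toℕ j) ≡ offset j ℤ.+ excess (toℕ j)
  excessOver-start j = excessOver-unwrapped j ℕ.≤-refl (Fin.toℕ<n j)

  rises⇒leastArgMin : ∑ c ≡ ∑ d → ∀ j → (∀ i → i < k → Rises j i) → LeastArgMin excess (suc k) (toℕ j)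
  rises⇒leastArgMin ∑c≡∑d j rises = record { before = before ; after = after }
    where
    before : ∀ {m} → m < toℕ j → excess (toℕ j) ℤ.< excess m
    before {m} m<j with window-end-wrapped (ℕ.s≤s⁻¹ (Fin.toℕ<n j)) m<j
    ... | i , i<k , end≡ = ℤ.suc[i]≤j⇒i<j (subst₂ ℤ._≤_
          (trans (excessOver-start j) (cong (ℤ._+ excess (toℕ j)) (offset-suc m<j)))
          (trans (cong (excessOver j) end≡) (excessOver-wrapped ∑c≡∑d j m<j))
          (rises i i<k))
    after : ∀ {m} → toℕ j < m → m < suc k → excess (toℕ j) ℤ.≤ excess m
    after j<m m<1+k with window-end-inside j<m (ℕ.s≤s⁻¹ m<1+k)
    ... | i , i<k , end≡ = +-cancelˡ-≤ (offset j) (subst₂ ℤ._≤_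
          (excessOver-start j)
          (trans (cong (excessOver j) end≡) (excessOver-unwrapped j (ℕ.<⇒≤ j<m) m<1+k))
          (rises i i<k))

  leastArgMin⇒rises : ∑ c ≡ ∑ d → ∀ j → LeastArgMin excess (suc k) (toℕ j) → ∀ i → i < k → Rises j i
  leastArgMin⇒rises ∑c≡∑d j min i i<k with window-end-cases {j = toℕ j} i<k
  ... | inj₁ end≤k = subst₂ ℤ._≤_
        (sym (excessOver-start j))
        (sym (excessOver-unwrapped j (ℕ.m≤m+n (toℕ j) (suc i)) (s≤s end≤k)))
        (ℤ.+-monoʳ-≤ (offset j) (LeastArgMin.after min (ℕ.m<m+n (toℕ j) (s≤s z≤n)) (s≤s end≤k)))
  ... | inj₂ (r , r<j , end≡) = subst₂ ℤ._≤_
        (sym (trans (excessOver-start j) (cong (ℤ._+ excess (toℕ j)) (offset-suc r<j))))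
        (trans (sym (excessOver-wrapped ∑c≡∑d j r<j)) (cong (excessOver j) (sym end≡)))
        (ℤ.i<j⇒suc[i]≤j (LeastArgMin.before min r<j))

  InC⇔leastArgMin : ∑ c ≡ ∑ d → ∀ j → InC (suc k) c j d ⇔ LeastArgMin excess (suc k) (toℕ j)
  InC⇔leastArgMin ∑c≡∑d j = mk⇔
    (λ inC → rises⇒leastArgMin ∑c≡∑d j (proj₂ (Equivalence.to (InC⇔nonneg×rises j) inC)))
    (λ min → Equivalence.from (InC⇔nonneg×rises j)
               (leastArgMin⇒cvec-nonneg j min , leastArgMin⇒rises ∑c≡∑d j min))

lemma3p22 : (N k : ℕ) .{{_ : NonZero k}} → 1 ≤ N → 2 ≤ k →
            (c : Fin k → ℕ) → WeakComp N k c →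
            (d : Fin k → ℕ) → WeakComp N k d →
            ∃! _≡_ (λ (j : Fin k) → InC k c j d)
lemma3p22 N (suc k) _ _ c ∑c≡N d ∑d≡N with leastArgMin-exists (excess c d) k
... | j , j<1+k , min = j* , Equivalence.from (InC⇔ j*) min* , unique
  where
  ∑c≡∑d : ∑ c ≡ ∑ d
  ∑c≡∑d = trans ∑c≡N (sym ∑d≡N)
  InC⇔ : ∀ j′ → InC (suc k) c j′ d ⇔ LeastArgMin (excess c d) (suc k) (toℕ j′)
  InC⇔ = InC⇔leastArgMin c d ∑c≡∑d
  j* : Fin (suc k)
  j* = fromℕ< j<1+k
  min* : LeastArgMin (excess c d) (suc k) (toℕ j*)
  min* = subst (LeastArgMin (excess c d) (suc k)) (sym (Fin.toℕ-fromℕ< j<1+k)) min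
  unique : ∀ {j′} → InC (suc k) c j′ d → j* ≡ j′
  unique {j′} inC = Fin.toℕ-injective
    (leastArgMin-unique (Fin.toℕ<n j*) (Fin.toℕ<n j′) min* (Equivalence.to (InC⇔ j′) inC))
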